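{- Let $T$ be a plane graph with quadrangular outer face and triangular inner faces, endowed with a transversal edge-partition, and additionally color the four outer edges blue. Then there is no monochromatic inner face: each inner face of $T$ has two sides of one color and one side of the other color.
   Context: A transversal edge-partition of such a $T$ colors each inner edge (edge not on the outer face) red or blue such that: (C1) around each inner vertex, the incident edges form in clockwise order a nonempty interval of red edges, a nonempty interval of blue edges, a nonempty interval of red edges, and a nonempty interval of blue edges; (C2) writing $a_1,a_2,a_3,a_4$ for the outer vertices in clockwise order, all inner edges incident to $a_1$ and $a_3$ are of one color and all inner edges incident to $a_2$ and $a_4$ are of the other color. -}

module Defs where

open import Data.Nat using (ℕ; zero; suc; _+_; _*_; _≤_; _<_; _≤ᵇ_)
open import Data.Fin using (Fin; toℕ)
open import Data.Bool using (Bool; true; false; not; if_then_else_)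
open import Data.List.Base using (List; upTo; allFin; map)
open import Data.Bool.ListAction using (and)
open import Data.Nat.ListAction using (sum)
open import Data.Product using (Σ; ∃; ∃-syntax; _×_; _,_)
open import Data.Sum using (_⊎_)
open import Relation.Nullary using (¬_)
open import Relation.Binary.PropositionalEquality using (_≡_; _≢_)

-- Plane graphs are encoded as combinatorial maps (rotation systems).
-- Darts (half-edges) are Fin n.  α = the involution pairing the two
-- darts of an edge, σ = clockwise rotation of darts around their
-- origin vertex, φ = σ ∘ α = the face permutation.
-- Vertices = σ-orbits, edges = α-orbits, faces = φ-orbits.

iter : ∀ {A : Set} → (A → A) → ℕ → A → A
iter f zero    x = x
iter f (suc k) x = f (iter f k x)

-- number of orbits of a map f on Fin n: count darts that are the
-- minimal element (w.r.t. toℕ) of their orbit (orbits have size ≤ n).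
isOrbitMin : ∀ {n} → (Fin n → Fin n) → Fin n → Bool
isOrbitMin {n} f d = and (map (λ k → toℕ d ≤ᵇ toℕ (iter f k d)) (upTo n))

numOrbits : ∀ {n} → (Fin n → Fin n) → ℕ
numOrbits {n} f = sum (map (λ d → if isOrbitMin f d then 1 else 0) (allFin n))

data Reach {n : ℕ} (α σ : Fin n → Fin n) : Fin n → Fin n → Set where
  here  : ∀ {d} → Reach α σ d d
  viaα  : ∀ {d e} → Reach α σ (α d) e → Reach α σ d e
  viaσ  : ∀ {d e} → Reach α σ (σ d) e → Reach α σ d e

record PlaneMap (n : ℕ) : Set where
  field
    α σ σ⁻¹ : Fin n → Fin n
    α-invol   : ∀ d → α (α d) ≡ d
    α-nofix   : ∀ d → α d ≢ d
    σ-left    : ∀ d → σ⁻¹ (σ d) ≡ d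
    σ-right   : ∀ d → σ (σ⁻¹ d) ≡ d
    connected : ∀ d e → Reach α σ d e

  φ : Fin n → Fin n
  φ d = σ (α d)

  field
    -- Euler's formula V - E + F = 2 with E = n/2 (genus 0: the map is plane)
    euler : 2 * numOrbits σ + 2 * numOrbits φ ≡ n + 4

  sameV : Fin n → Fin n → Set
  sameV d e = ∃[ k ] iter σ k d ≡ e

  sameF : Fin n → Fin n → Set
  sameF d e = ∃[ k ] iter φ k d ≡ e

  field
    noLoop     : ∀ d → ¬ sameV d (α d)
    noMultiple : ∀ d e → sameV d e → sameV (α d) (α e) → d ≡ e
    r : Fin n

  onOuter : Fin n → Set
  onOuter d = sameF r d

  field
    outerQuad   : iter φ 4 r ≡ r × iter φ 2 r ≢ r
    innerTri    : ∀ d → ¬ onOuter d → iter φ 3 d ≡ d × φ d ≢ d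

  -- outer vertices a₁,a₂,a₃,a₄ (in order along the outer face):
  -- aᵢ is the origin of the dart iter φ (i-1) r
  a : ℕ → Fin n
  a i = iter φ i r

  innerVertex : Fin n → Set
  innerVertex d = ∀ k → ¬ onOuter (iter σ k d)

  outerEdge : Fin n → Set
  outerEdge d = onOuter d ⊎ onOuter (α d)

  innerEdge : Fin n → Set
  innerEdge d = ¬ outerEdge d

  adj : Fin n → Fin n → Set
  adj d e = ∃[ x ] sameV d x × sameV (α x) e

  triangle : Fin n → Fin n → Fin n → Set
  triangle d e f = adj d e × adj e f × adj f d
                 × ¬ sameV d e × ¬ sameV e f × ¬ sameV f d

  cornerOf : Fin n → Fin n → Set
  cornerOf x d = sameV x d ⊎ sameV (φ x) d ⊎ sameV (φ (φ x)) d

  facial : Fin n → Fin n → Fin n → Set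
  facial d e f = ∃[ x ] iter φ 3 x ≡ x × cornerOf x d × cornerOf x e × cornerOf x f

-- Irreducible triangulation of the 4-gon: no separating triangle
-- (every 3-cycle bounds a face) and at least one inner vertex.
Irreducible : ∀ {n} → PlaneMap n → Set
Irreducible {n} T = (∀ d e f → triangle d e f → facial d e f)
                  × ∃[ d ] innerVertex d
  where open PlaneMap T

red blue : Bool
red  = true
blue = false

record TransversalColouring {n : ℕ} (T : PlaneMap n) (col : Fin n → Bool) : Set where
  open PlaneMap T
  field
    edgeColour : ∀ d → col (α d) ≡ col d
    C1 : ∀ d → innerVertex d →
         ∃[ d₀ ] sameV d d₀ ×
         Σ ℕ λ p → Σ ℕ λ q → Σ ℕ λ s → Σ ℕ λ t →
           1 ≤ p × 1 ≤ q × 1 ≤ s × 1 ≤ t ×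
           iter σ (p + q + s + t) d₀ ≡ d₀ ×
           (∀ j → 1 ≤ j → j < p + q + s + t → iter σ j d₀ ≢ d₀) ×
           (∀ j → j < p → col (iter σ j d₀) ≡ red) ×
           (∀ j → p ≤ j → j < p + q → col (iter σ j d₀) ≡ blue) ×
           (∀ j → p + q ≤ j → j < p + q + s → col (iter σ j d₀) ≡ red) ×
           (∀ j → p + q + s ≤ j → j < p + q + s + t → col (iter σ j d₀) ≡ blue)
    C2 : ∃[ c ] (∀ d → innerEdge d → sameV (a 0) d ⊎ sameV (a 2) d → col d ≡ c)
              × (∀ d → innerEdge d → sameV (a 1) d ⊎ sameV (a 3) d → col d ≡ not c)
    outerBlue : ∀ d → outerEdge d → col d ≡ blue

{-# OPTIONS --safe #-}
-- Double counting in the style of Euler's formula.  Let V, F be the numbers of vertices and faces,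
-- I the number of inner darts and S the number of bichromatic angles (darts x with col x ≠ col (σ x)).
-- Inner faces are triangles, so 3F ≤ I + 3.  An angle at a vertex is a corner of a face; a triangle has
-- 0 or 2 bichromatic corners, the all-blue outer face has none, and so has a monochromatic inner face:
-- 3S + 6 ≤ 2I.  By (C1) an inner vertex has at least 4 bichromatic angles.  Among the outer vertices, the
-- two whose inner edges are red also carry blue outer edges, hence have 2 bichromatic angles; this needs
-- an inner edge at them, which irreducibility provides.  (If two outer corners share a vertex, there are
-- at most three outer vertices.)  So 4V ≤ S + 12, and with 2V + 2F = n + 4 and I + 4 ≤ n this gives
-- 6n + 24 ≤ 6n + 18.
module Submission where

open import Defs
open import Data.Bool using (Bool; true; false; not; if_then_else_; _∧_; _xor_; T) renaming (_≟_ to _≟ᵇ_)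
open import Data.Bool.Properties using (T-∧; xor-same; not-¬; ¬-not)
open import Data.Empty using (⊥; ⊥-elim)
open import Data.Fin using (Fin; zero; suc; toℕ; fromℕ<)
open import Data.Fin.Patterns using (0F; 1F; 2F; 3F; 4F; 5F; 6F; 7F; 8F; 9F)
open import Data.Fin.Permutation using (permutation)
import Data.Fin.Properties as Fin
open import Data.List using ([]; _∷_; map; length; upTo; applyUpTo; tabulate)
open import Data.List.Properties using (map-cong-local)
open import Data.List.Membership.Propositional.Properties using (∈-upTo⁺)
open import Data.List.Relation.Unary.All as All using (All; []; _∷_)
open import Data.List.Relation.Unary.All.Properties using (all⁺; applyUpTo⁺₂)
open import Data.List.Relation.Unary.AllPairs using (AllPairs; []; _∷_)
open import Data.List.Relation.Unary.Linked using ([-]; _∷_)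
open import Data.List.Relation.Unary.Linked.Properties using (Linked⇒AllPairs)
open import Data.List.Relation.Unary.Unique.Propositional using (Unique)
import Data.List.Relation.Unary.Unique.Propositional.Properties as Unique
open import Data.Nat using (ℕ; zero; suc; _+_; _*_; _∸_; _≤_; _<_; _%_; _/_; z≤n; s≤s; s≤s⁻¹; s<s⁻¹)
open import Data.Nat.DivMod using (m≡m%n+[m/n]*n; m%n<n)
open import Data.Nat.ListAction using () renaming (sum to listSum)
open import Data.Nat.Tactic.RingSolver using (solve-∀)
open import Data.Nat.Properties
open import Algebra.Properties.Semiring.Sum +-*-semiring
  using (sum; sum-cong-≗; sum-replicate-zero; ∑-distrib-+; ∑-comm; sum-permute; *-distribˡ-sum)
open import Algebra.Properties.CommutativeSemigroup +-commutativeSemigroup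
  using () renaming (x∙yz≈y∙xz to +-exchange)
open import Algebra.Properties.CommutativeSemigroup *-commutativeSemigroup
  using () renaming (x∙yz≈y∙xz to *-exchange)
open import Data.Product using (∃; ∃₂; ∃-syntax; _×_; _,_; proj₁; proj₂)
open import Data.Sum using (_⊎_; inj₁; inj₂)
import Data.Sum
open import Function using (_∘_; id; const; Equivalence)
open import Data.Vec.Functional using (updateAt)
open import Data.Vec.Functional.Properties using (updateAt-minimal)
open import Relation.Binary using (Decidable; tri<; tri≈; tri>)
open import Relation.Binary.PropositionalEquality
open import Relation.Nullary using (¬_; Dec; yes; no; does; ¬?; _×-dec_)
open import Relation.Nullary.Decidable using (dec-true; dec-false; map′)

𝟙 : Bool → ℕ
𝟙 b = if b then 1 else 0

𝟙-∧ : ∀ a b → 𝟙 a * 𝟙 b ≡ 𝟙 (a ∧ b)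
𝟙-∧ true  b = +-identityʳ (𝟙 b)
𝟙-∧ false b = refl

sum-mono-≤ : ∀ {n} {f g : Fin n → ℕ} → (∀ i → f i ≤ g i) → sum f ≤ sum g
sum-mono-≤ {zero}  f≤g = z≤n
sum-mono-≤ {suc n} f≤g = +-mono-≤ (f≤g zero) (sum-mono-≤ (f≤g ∘ suc))

sum-const-1 : ∀ n → sum {n} (const 1) ≡ n
sum-const-1 zero    = refl
sum-const-1 (suc n) = cong suc (sum-const-1 n)

sum-updateAt-0 : ∀ {n} (f : Fin n → ℕ) i → sum f ≡ f i + sum (updateAt f i (const 0))
sum-updateAt-0 {suc n} f zero    = refl
sum-updateAt-0 {suc n} f (suc i) =
  trans (cong (f zero +_) (sum-updateAt-0 (f ∘ suc) i)) (+-exchange (f zero) (f (suc i)) _)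

sum-∘-inverse : ∀ {n} (π π⁻¹ : Fin n → Fin n) → (∀ x → π (π⁻¹ x) ≡ x) → (∀ x → π⁻¹ (π x) ≡ x) →
                (f : Fin n → ℕ) → sum (f ∘ π) ≡ sum f
sum-∘-inverse π π⁻¹ ππ⁻¹ π⁻¹π f = sym (sum-permute f (permutation π π⁻¹ ππ⁻¹ π⁻¹π))

listSum-≤-sum : ∀ {n} (f : Fin n → ℕ) {xs} → Unique xs → listSum (map f xs) ≤ sum f
listSum-≤-sum f {[]}     []             = z≤n
listSum-≤-sum f {x ∷ xs} (x∉xs ∷ xs!) = begin
  f x + listSum (map f xs)  ≡⟨ cong (λ ys → f x + listSum ys) (map-cong-local (All.map agree x∉xs)) ⟩
  f x + listSum (map f′ xs) ≤⟨ +-monoʳ-≤ (f x) (listSum-≤-sum f′ xs!) ⟩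
  f x + sum f′              ≡⟨ sum-updateAt-0 f x ⟨
  sum f                     ∎
  where
  open ≤-Reasoning
  f′ : Fin _ → ℕ
  f′ = updateAt f x (const 0)
  agree : ∀ {y} → x ≢ y → f y ≡ f′ y
  agree x≢y = sym (updateAt-minimal _ x f (x≢y ∘ sym))

listSum-≥ : ∀ {A : Set} {f : A → ℕ} {c xs} → All (λ x → c ≤ f x) xs → length xs * c ≤ listSum (map f xs)
listSum-≥ []           = z≤n
listSum-≥ (c≤fx ∷ c≤f) = +-mono-≤ c≤fx (listSum-≥ c≤f)

sum-≥-Unique : ∀ {n} (f : Fin n → ℕ) {c xs} → Unique xs → All (λ x → c ≤ f x) xs → length xs * c ≤ sum f
sum-≥-Unique f xs! c≤f = ≤-trans (listSum-≥ c≤f) (listSum-≤-sum f xs!)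

sum-𝟙-≤-1 : ∀ {n} (p : Fin n → Bool) → (∀ {i j} → T (p i) → T (p j) → i ≡ j) → sum (𝟙 ∘ p) ≤ 1
sum-𝟙-≤-1 {zero}  p p-unique = z≤n
sum-𝟙-≤-1 {suc n} p p-unique with p zero in p0
... | false = sum-𝟙-≤-1 (p ∘ suc) (λ pi pj → Fin.suc-injective (p-unique pi pj))
... | true  = ≤-reflexive (cong suc (trans (sum-cong-≗ vanish) (sum-replicate-zero n)))
  where
  vanish : ∀ i → 𝟙 (p (suc i)) ≡ 0
  vanish i with p (suc i) in pi
  ... | false = refl
  ... | true  = ⊥-elim (Fin.0≢1+n (p-unique (subst T (sym p0) _) (subst T (sym pi) _)))

sum-slack : ∀ {n} {f g : Fin n → ℕ} {c xs} → (∀ x → f x ≤ g x) → Unique xs → All (λ x → c + f x ≤ g x) xs →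
            sum f + length xs * c ≤ sum g
sum-slack {f = f} {g} {c} {xs} f≤g xs! slack = begin
  sum f + length xs * c
    ≤⟨ +-monoʳ-≤ (sum f) (sum-≥-Unique (λ x → g x ∸ f x) xs! (All.map (m+n≤o⇒m≤o∸n _) slack)) ⟩
  sum f + sum (λ x → g x ∸ f x) ≡⟨ ∑-distrib-+ f (λ x → g x ∸ f x) ⟨
  sum (λ x → f x + (g x ∸ f x)) ≡⟨ sum-cong-≗ (λ x → m+[n∸m]≡n (f≤g x)) ⟩
  sum g                         ∎
  where open ≤-Reasoning

3*sum≡sum-rotations : ∀ {n} (π π⁻¹ : Fin n → Fin n) → (∀ x → π (π⁻¹ x) ≡ x) → (∀ x → π⁻¹ (π x) ≡ x) →
                      (h : Fin n → ℕ) → 3 * sum h ≡ sum (λ x → h x + h (π x) + h (π (π x)))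
3*sum≡sum-rotations π π⁻¹ ππ⁻¹ π⁻¹π h = begin
  3 * sum h                                 ≡⟨ cong (λ t → sum h + (sum h + t)) (+-identityʳ (sum h)) ⟩
  sum h + (sum h + sum h)                   ≡⟨ +-assoc (sum h) (sum h) (sum h) ⟨
  sum h + sum h + sum h
    ≡⟨ cong₂ (λ a b → sum h + a + b) (invariant h) (trans (invariant h) (invariant (h ∘ π))) ⟩
  sum h + sum (h ∘ π) + sum (h ∘ π ∘ π)     ≡⟨ cong (_+ sum (h ∘ π ∘ π)) (∑-distrib-+ h (h ∘ π)) ⟨
  sum (λ x → h x + h (π x)) + sum (h ∘ π ∘ π) ≡⟨ ∑-distrib-+ (λ x → h x + h (π x)) (h ∘ π ∘ π) ⟨
  sum (λ x → h x + h (π x) + h (π (π x)))   ∎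
  where
  open ≡-Reasoning
  invariant : ∀ g → sum g ≡ sum (g ∘ π)
  invariant g = sym (sum-∘-inverse π π⁻¹ ππ⁻¹ π⁻¹π g)

listSum-map-tabulate : ∀ {m n} (g : Fin m → ℕ) (h : Fin n → Fin m) → listSum (map g (tabulate h)) ≡ sum (g ∘ h)
listSum-map-tabulate {n = zero}  g h = refl
listSum-map-tabulate {n = suc n} g h = cong (g (h zero) +_) (listSum-map-tabulate g (h ∘ suc))

xor-cycle-≤-2 : ∀ a b c → 𝟙 (a xor b) + 𝟙 (b xor c) + 𝟙 (c xor a) ≤ 2
xor-cycle-≤-2 true  true  true  = z≤n
xor-cycle-≤-2 true  true  false = ≤-refl
xor-cycle-≤-2 true  false true  = ≤-refl
xor-cycle-≤-2 true  false false = ≤-refl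
xor-cycle-≤-2 false true  true  = ≤-refl
xor-cycle-≤-2 false true  false = ≤-refl
xor-cycle-≤-2 false false true  = ≤-refl
xor-cycle-≤-2 false false false = z≤n

change-point : ∀ (c : ℕ → Bool) {b k} → c 0 ≡ b → c k ≡ not b → ∃[ j ] c j ≡ b × c (suc j) ≡ not b
change-point c {b} {zero}  c₀≡b c₀≡¬b = ⊥-elim (not-¬ c₀≡b c₀≡¬b)
change-point c {b} {suc k} c₀≡b cₖ₊₁≡¬b with c k ≟ᵇ b
... | yes cₖ≡b = k , cₖ≡b , cₖ₊₁≡¬b
... | no  cₖ≢b = change-point c c₀≡b (¬-not cₖ≢b)

module Orbits {n : ℕ} (f f⁻¹ : Fin n → Fin n) (f⁻¹∘f : ∀ x → f⁻¹ (f x) ≡ x) where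

  infix 4 _∼_ _∼?_

  _∼_ : Fin n → Fin n → Set
  x ∼ y = ∃[ k ] iter f k x ≡ y

  f-injective : ∀ {x y} → f x ≡ f y → x ≡ y
  f-injective {x} {y} eq = trans (sym (f⁻¹∘f x)) (trans (cong f⁻¹ eq) (f⁻¹∘f y))

  iter-injective : ∀ k {x y} → iter f k x ≡ iter f k y → x ≡ y
  iter-injective zero    eq = eq
  iter-injective (suc k) eq = iter-injective k (f-injective eq)

  iter-+ : ∀ j k x → iter f (j + k) x ≡ iter f j (iter f k x)
  iter-+ zero    k x = refl
  iter-+ (suc j) k x = cong f (iter-+ j k x)

  iter-comm : ∀ j k x → iter f j (iter f k x) ≡ iter f k (iter f j x)
  iter-comm j k x = trans (sym (iter-+ j k x)) (trans (cong (λ m → iter f m x) (+-comm j k)) (iter-+ k j x))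

  iter-* : ∀ {P x} → iter f P x ≡ x → ∀ m → iter f (m * P) x ≡ x
  iter-* per zero = refl
  iter-* {P} {x} per (suc m) = trans (iter-+ P (m * P) x) (trans (cong (iter f P) (iter-* per m)) per)

  iter-% : ∀ {P x} → iter f (suc P) x ≡ x → ∀ k → iter f k x ≡ iter f (k % suc P) x
  iter-% {P} {x} per k = begin
    iter f k x                                   ≡⟨ cong (λ m → iter f m x) (m≡m%n+[m/n]*n k (suc P)) ⟩
    iter f (k % suc P + k / suc P * suc P) x     ≡⟨ iter-+ (k % suc P) _ x ⟩
    iter f (k % suc P) (iter f (k / suc P * suc P) x) ≡⟨ cong (iter f (k % suc P)) (iter-* per (k / suc P)) ⟩
    iter f (k % suc P) x                         ∎
    where open ≡-Reasoning

  bounded-period : ∀ x → ∃[ P ] suc P ≤ n × iter f (suc P) x ≡ x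
  bounded-period x with i , j , i<j , fⁱx≡fʲx ← Fin.pigeonhole (n<1+n n) (λ (i : Fin (suc n)) → iter f (toℕ i) x) =
    toℕ j ∸ suc (toℕ i) , P<n , iter-injective (toℕ i) (begin
      iter f (toℕ i) (iter f (suc P) x) ≡⟨ iter-+ (toℕ i) (suc P) x ⟨
      iter f (toℕ i + suc P) x          ≡⟨ cong (λ m → iter f m x) i+[1+P]≡j ⟩
      iter f (toℕ j) x                  ≡⟨ fⁱx≡fʲx ⟨
      iter f (toℕ i) x                  ∎)
    where
    open ≡-Reasoning
    P : ℕ
    P = toℕ j ∸ suc (toℕ i)
    1+P≡j-i : suc P ≡ toℕ j ∸ toℕ i
    1+P≡j-i = sym (+-∸-assoc 1 i<j)
    i+[1+P]≡j : toℕ i + suc P ≡ toℕ j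
    i+[1+P]≡j = trans (cong (toℕ i +_) 1+P≡j-i) (m+[n∸m]≡n (<⇒≤ i<j))
    P<n : suc P ≤ n
    P<n = ≤-trans (≤-reflexive 1+P≡j-i) (≤-trans (m∸n≤m (toℕ j) (toℕ i)) (s≤s⁻¹ (Fin.toℕ<n j)))

  ∼-within-period : ∀ {P x y} → iter f (suc P) x ≡ x → x ∼ y → ∃[ j ] j < suc P × iter f j x ≡ y
  ∼-within-period {P} per (k , fᵏx≡y) = k % suc P , m%n<n k (suc P) , trans (sym (iter-% per k)) fᵏx≡y

  ∼-within-n : ∀ {x y} → x ∼ y → ∃[ j ] j < n × iter f j x ≡ y
  ∼-within-n {x} x∼y with P , P<n , per ← bounded-period x with j , j≤P , eq ← ∼-within-period per x∼y =
    j , <-≤-trans j≤P P<n , eq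

  _∼?_ : Decidable _∼_
  x ∼? y = map′ (λ (j , eq) → toℕ j , eq) bounded (Fin.any? λ j → iter f (toℕ j) x Fin.≟ y)
    where
    bounded : x ∼ y → ∃ λ (j : Fin n) → iter f (toℕ j) x ≡ y
    bounded x∼y with j , j<n , eq ← ∼-within-n x∼y =
      fromℕ< j<n , trans (cong (λ m → iter f m x) (Fin.toℕ-fromℕ< j<n)) eq

  ∼-refl : ∀ {x} → x ∼ x
  ∼-refl = 0 , refl

  ∼-sym : ∀ {x y} → x ∼ y → y ∼ x
  ∼-sym {x} x∼y with P , _ , per ← bounded-period x with j , j≤P , refl ← ∼-within-period per x∼y =
    suc P ∸ j , (begin
      iter f (suc P ∸ j) (iter f j x) ≡⟨ iter-+ (suc P ∸ j) j x ⟨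
      iter f (suc P ∸ j + j) x        ≡⟨ cong (λ m → iter f m x) (m∸n+n≡m (<⇒≤ j≤P)) ⟩
      iter f (suc P) x                ≡⟨ per ⟩
      x                               ∎)
    where open ≡-Reasoning

  ∼-trans : ∀ {x y z} → x ∼ y → y ∼ z → x ∼ z
  ∼-trans {x} (j , refl) (k , refl) = k + j , iter-+ k j x

  ∼-from-does : ∀ {x y} → T (does (x ∼? y)) → x ∼ y
  ∼-from-does {x} {y} = witness (x ∼? y)
    where
    witness : (x∼?y : Dec (x ∼ y)) → T (does x∼?y) → x ∼ y
    witness (yes x∼y) _ = x∼y

  NoPeriodBelow : ℕ → Fin n → Set
  NoPeriodBelow P x = ∀ j → 0 < j → j < P → iter f j x ≢ x

  iter-≢ : ∀ {P x i j} → NoPeriodBelow P x → i < j → j < P → iter f i x ≢ iter f j x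
  iter-≢ {P} {x} {i} {j} aperiodic i<j j<P fⁱx≡fʲx =
    aperiodic (j ∸ i) (m<n⇒0<n∸m i<j) (≤-<-trans (m∸n≤m j i) j<P) (iter-injective i (begin
      iter f i (iter f (j ∸ i) x) ≡⟨ iter-+ i (j ∸ i) x ⟨
      iter f (i + (j ∸ i)) x      ≡⟨ cong (λ m → iter f m x) (m+[n∸m]≡n (<⇒≤ i<j)) ⟩
      iter f j x                  ≡⟨ fⁱx≡fʲx ⟨
      iter f i x                  ∎))
    where open ≡-Reasoning

  iterates-Unique : ∀ {P x} → NoPeriodBelow P x → Unique (applyUpTo (λ j → iter f j x) P)
  iterates-Unique aperiodic = Unique.applyUpTo⁺₁ _ _ (iter-≢ aperiodic)

  iterates-Unique-at : ∀ {P x js} → NoPeriodBelow P x → AllPairs _<_ js → All (_< P) js →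
                       Unique (map (λ j → iter f j x) js)
  iterates-Unique-at aperiodic []             []           = []
  iterates-Unique-at {P} {x} aperiodic (i<js ∷ js<js) (i<P ∷ js<P) =
    apart i<js js<P ∷ iterates-Unique-at aperiodic js<js js<P
    where
    apart : ∀ {i js} → All (i <_) js → All (_< P) js → All (iter f i x ≢_) (map (λ j → iter f j x) js)
    apart []           []           = []
    apart (i<j ∷ i<js) (j<P ∷ js<P) = iter-≢ aperiodic i<j j<P ∷ apart i<js js<P

  iterate-injective : ∀ {P x} → NoPeriodBelow P x → ∀ {i j : Fin P} → iter f (toℕ i) x ≡ iter f (toℕ j) x → i ≡ j
  iterate-injective aperiodic {i} {j} eq with <-cmp (toℕ i) (toℕ j)
  ... | tri< i<j _ _ = ⊥-elim (iter-≢ aperiodic i<j (Fin.toℕ<n j) eq)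
  ... | tri≈ _ i≡j _ = Fin.toℕ-injective i≡j
  ... | tri> _ _ j<i = ⊥-elim (iter-≢ aperiodic j<i (Fin.toℕ<n i) (sym eq))

  orbitMin-≤ : ∀ {x y} → T (isOrbitMin f x) → x ∼ y → toℕ x ≤ toℕ y
  orbitMin-≤ {x} minimal x∼y with j , j<n , refl ← ∼-within-n x∼y =
    ≤ᵇ⇒≤ _ _ (All.lookup (all⁺ _ (upTo n) minimal) (∈-upTo⁺ j<n))

  orbitMin-unique : ∀ {x y} → T (isOrbitMin f x) → T (isOrbitMin f y) → x ∼ y → x ≡ y
  orbitMin-unique x-min y-min x∼y =
    Fin.toℕ-injective (≤-antisym (orbitMin-≤ x-min x∼y) (orbitMin-≤ y-min (∼-sym x∼y)))

  orbitMin : Fin n → ℕ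
  orbitMin x = 𝟙 (isOrbitMin f x)

  numOrbits-sum : numOrbits f ≡ sum orbitMin
  numOrbits-sum = listSum-map-tabulate orbitMin id

  orbitMins-≤-1 : ∀ y → sum (λ x → orbitMin x * 𝟙 (does (y ∼? x))) ≤ 1
  orbitMins-≤-1 y = subst (_≤ 1) (sum-cong-≗ λ x → sym (𝟙-∧ (isOrbitMin f x) _))
                           (sum-𝟙-≤-1 (λ x → isOrbitMin f x ∧ does (y ∼? x)) one-minimum)
    where
    one-minimum : ∀ {i j} → T (isOrbitMin f i ∧ does (y ∼? i)) → T (isOrbitMin f j ∧ does (y ∼? j)) → i ≡ j
    one-minimum {i} {j} ti tj with i-min , y∼i ← Equivalence.to T-∧ ti with j-min , y∼j ← Equivalence.to T-∧ tj =
      orbitMin-unique i-min j-min (∼-trans (∼-sym (∼-from-does y∼i)) (∼-from-does y∼j))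

  orbitMass : ∀ {k} → (Fin k → ℕ) → (Fin k → Fin n) → Fin n → ℕ
  orbitMass w p x = sum λ j → w j * 𝟙 (does (p j ∼? x))

  orbitMass-≥ : ∀ {k} (w : Fin k → ℕ) (p : Fin k → Fin n) {x c js} → Unique js →
                All (λ j → p j ∼ x × c ≤ w j) js → length js * c ≤ orbitMass w p x
  orbitMass-≥ w p {x} js! marked = sum-≥-Unique _ js! (All.map weigh marked)
    where
    weigh : ∀ {c j} → p j ∼ x × c ≤ w j → c ≤ w j * 𝟙 (does (p j ∼? x))
    weigh {j = j} (pj∼x , c≤wj) rewrite dec-true (p j ∼? x) pj∼x | *-identityʳ (w j) = c≤wj

  orbitMass-≥-point : ∀ {k} (w : Fin k → ℕ) (p : Fin k → Fin n) {x j} → p j ∼ x → w j ≤ orbitMass w p x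
  orbitMass-≥-point w p {j = j} pj∼x =
    subst (_≤ orbitMass w p _) (*-identityˡ (w j)) (orbitMass-≥ w p ([] ∷ []) ((pj∼x , ≤-refl) ∷ []))

  ∑-orbitMin-orbitMass-≤ : ∀ {k} (w : Fin k → ℕ) (p : Fin k → Fin n) →
                           sum (λ x → orbitMin x * orbitMass w p x) ≤ sum w
  ∑-orbitMin-orbitMass-≤ {k} w p = begin
    sum (λ x → orbitMin x * sum (λ j → w j * inOrbit j x))
      ≡⟨ sum-cong-≗ (λ x → *-distribˡ-sum (orbitMin x) (λ j → w j * inOrbit j x)) ⟩
    sum (λ x → sum (λ j → orbitMin x * (w j * inOrbit j x))) ≡⟨ ∑-comm (λ x j → orbitMin x * (w j * inOrbit j x)) ⟩
    sum (λ j → sum (λ x → orbitMin x * (w j * inOrbit j x))) ≡⟨ sum-cong-≗ (λ j → pull-out j) ⟩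
    sum (λ j → w j * sum (λ x → orbitMin x * inOrbit j x))   ≤⟨ sum-mono-≤ (λ j → *-monoʳ-≤ (w j) (orbitMins-≤-1 (p j))) ⟩
    sum (λ j → w j * 1)                                      ≡⟨ sum-cong-≗ (λ j → *-identityʳ (w j)) ⟩
    sum w                                                    ∎
    where
    open ≤-Reasoning
    inOrbit : Fin k → Fin n → ℕ
    inOrbit j x = 𝟙 (does (p j ∼? x))
    pull-out : ∀ j → sum (λ x → orbitMin x * (w j * inOrbit j x)) ≡ w j * sum (λ x → orbitMin x * inOrbit j x)
    pull-out j = trans (sum-cong-≗ λ x → *-exchange (orbitMin x) (w j) (inOrbit j x))
                       (sym (*-distribˡ-sum (w j) (λ x → orbitMin x * inOrbit j x)))

  -- Each orbit is counted once, at its minimal dart.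
  orbits-≤ : ∀ {k c} (g : Fin n → ℕ) (w : Fin k → ℕ) (p : Fin k → Fin n) →
             (∀ x → c ≤ orbitMass g id x + orbitMass w p x) → c * numOrbits f ≤ sum g + sum w
  orbits-≤ {c = c} g w p heavy = begin
    c * numOrbits f                                  ≡⟨ cong (c *_) numOrbits-sum ⟩
    c * sum orbitMin                                 ≡⟨ *-distribˡ-sum c orbitMin ⟩
    sum (λ x → c * orbitMin x)                       ≤⟨ sum-mono-≤ (λ x → counted x (isOrbitMin f x)) ⟩
    sum (λ x → orbitMin x * M x + orbitMin x * M′ x)
      ≡⟨ ∑-distrib-+ (λ x → orbitMin x * M x) (λ x → orbitMin x * M′ x) ⟩
    sum (λ x → orbitMin x * M x) + sum (λ x → orbitMin x * M′ x)
      ≤⟨ +-mono-≤ (∑-orbitMin-orbitMass-≤ g id) (∑-orbitMin-orbitMass-≤ w p) ⟩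
    sum g + sum w                                    ∎
    where
    open ≤-Reasoning
    M M′ : Fin n → ℕ
    M  = orbitMass g id
    M′ = orbitMass w p
    counted : ∀ x b → c * 𝟙 b ≤ 𝟙 b * M x + 𝟙 b * M′ x
    counted x false = ≤-reflexive (*-zeroʳ c)
    counted x true  = subst₂ _≤_ (sym (*-identityʳ c)) (sym (cong₂ _+_ (*-identityˡ (M x)) (*-identityˡ (M′ x)))) (heavy x)

module PlaneMapProperties {n : ℕ} (G : PlaneMap n) where
  open PlaneMap G public

  φ⁻¹ : Fin n → Fin n
  φ⁻¹ x = α (σ⁻¹ x)

  φ⁻¹∘φ : ∀ x → φ⁻¹ (φ x) ≡ x
  φ⁻¹∘φ x = trans (cong α (σ-left (α x))) (α-invol x)

  φ∘φ⁻¹ : ∀ x → φ (φ⁻¹ x) ≡ x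
  φ∘φ⁻¹ x = trans (cong σ (α-invol (σ⁻¹ x))) (σ-right x)

  α-swap : ∀ {x y} → α x ≡ y → x ≡ α y
  α-swap {x} αx≡y = trans (sym (α-invol x)) (cong α αx≡y)

  module V = Orbits σ σ⁻¹ σ-left
  module F = Orbits φ φ⁻¹ φ⁻¹∘φ

  onOuter? : ∀ x → Dec (onOuter x)
  onOuter? x = r F.∼? x

  onOuter-φ : ∀ {x} → onOuter x → onOuter (φ x)
  onOuter-φ x∈ = F.∼-trans x∈ (1 , refl)

  ¬onOuter-iter : ∀ {x} → ¬ onOuter x → ∀ j → ¬ onOuter (iter φ j x)
  ¬onOuter-iter x∉ j φʲx∈ = x∉ (F.∼-trans φʲx∈ (F.∼-sym (j , refl)))

  outer-period : ∀ {x} → onOuter x → iter φ 4 x ≡ x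
  outer-period (k , refl) = trans (F.iter-comm 4 k r) (cong (iter φ k) (proj₁ outerQuad))

  outer-not-2-periodic : ∀ {x} → onOuter x → iter φ 2 x ≢ x
  outer-not-2-periodic (k , refl) φ²x≡x = proj₂ outerQuad (F.iter-injective k (trans (sym (F.iter-comm 2 k r)) φ²x≡x))

  outer-NoPeriodBelow-4 : ∀ {x} → onOuter x → F.NoPeriodBelow 4 x
  outer-NoPeriodBelow-4 o 1 _ _ φx≡x  = outer-not-2-periodic o (trans (cong φ φx≡x) φx≡x)
  outer-NoPeriodBelow-4 o 2 _ _       = outer-not-2-periodic o
  outer-NoPeriodBelow-4 o 3 _ _ φ³x≡x =
    outer-NoPeriodBelow-4 o 1 (s≤s z≤n) (s≤s (s≤s z≤n)) (trans (sym (cong φ φ³x≡x)) (outer-period o))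
  outer-NoPeriodBelow-4 o (suc (suc (suc (suc _)))) _ (s≤s (s≤s (s≤s (s≤s ()))))

  outerDart : Fin n → Fin 4 → Fin n
  outerDart x i = iter φ (toℕ i) x

  outerDart-index : ∀ {x y} → onOuter x → onOuter y → ∃[ i ] outerDart x i ≡ y
  outerDart-index {x} ox oy with j , j<4 , eq ← F.∼-within-period (outer-period ox) (F.∼-trans (F.∼-sym ox) oy) =
    fromℕ< j<4 , trans (cong (λ m → iter φ m x) (Fin.toℕ-fromℕ< j<4)) eq

  outerDart-injective : ∀ {x i j} → onOuter x → outerDart x i ≡ outerDart x j → i ≡ j
  outerDart-injective o = F.iterate-injective (outer-NoPeriodBelow-4 o)

  inner-NoPeriodBelow-3 : ∀ {x} → ¬ onOuter x → F.NoPeriodBelow 3 x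
  inner-NoPeriodBelow-3 {x} x∉ 1 _ _ = proj₂ (innerTri x x∉)
  inner-NoPeriodBelow-3 {x} x∉ 2 _ _ φ²x≡x =
    proj₂ (innerTri x x∉) (trans (sym (cong φ φ²x≡x)) (proj₁ (innerTri x x∉)))
  inner-NoPeriodBelow-3 x∉ (suc (suc (suc _))) _ (s≤s (s≤s (s≤s ())))

  inner outer : Fin n → ℕ
  inner x = 𝟙 (not (does (onOuter? x)))
  outer x = 𝟙 (does (onOuter? x))

  numInner : ℕ
  numInner = sum inner

  inner-1 : ∀ {x} → ¬ onOuter x → inner x ≡ 1
  inner-1 {x} x∉ rewrite dec-false (onOuter? x) x∉ = refl

  numInner+4≤n : numInner + 4 ≤ n
  numInner+4≤n = begin
    sum inner + 4                 ≤⟨ +-monoʳ-≤ (sum inner) (sum-≥-Unique outer (F.iterates-Unique (outer-NoPeriodBelow-4 F.∼-refl))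
                                                                          (applyUpTo⁺₂ _ 4 λ j → outer-1 (j , refl))) ⟩
    sum inner + sum outer         ≡⟨ ∑-distrib-+ inner outer ⟨
    sum (λ x → inner x + outer x) ≡⟨ sum-cong-≗ (λ x → inner+outer (does (onOuter? x))) ⟩
    sum {n} (const 1)             ≡⟨ sum-const-1 n ⟩
    n                             ∎
    where
    open ≤-Reasoning
    outer-1 : ∀ {x} → onOuter x → 1 ≤ outer x
    outer-1 {x} x∈ rewrite dec-true (onOuter? x) x∈ = ≤-refl
    inner+outer : ∀ b → 𝟙 (not b) + 𝟙 b ≡ 1
    inner+outer true  = refl
    inner+outer false = refl

  faces-≤ : 3 * numOrbits φ ≤ numInner + 3
  faces-≤ = F.orbits-≤ inner weight root three-per-face
    where
    weight : Fin 1 → ℕ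
    weight _ = 3
    root : Fin 1 → Fin n
    root _ = r
    three-per-face : ∀ x → 3 ≤ F.orbitMass inner id x + F.orbitMass weight root x
    three-per-face x with onOuter? x
    ... | yes r∼x = ≤-trans (F.orbitMass-≥-point weight root {j = zero} r∼x) (m≤n+m _ (F.orbitMass inner id x))
    ... | no  x∉  = ≤-trans (F.orbitMass-≥ inner id (F.iterates-Unique (inner-NoPeriodBelow-3 x∉))
                                            (applyUpTo⁺₂ _ 3 λ j → F.∼-sym (j , refl) , corner-inner j))
                            (m≤m+n _ _)
      where
      corner-inner : ∀ j → 1 ≤ inner (iter φ j x)
      corner-inner j = ≤-reflexive (sym (inner-1 (¬onOuter-iter x∉ j)))

  outerDart-outer : ∀ {x} → onOuter x → ∀ i → onOuter (outerDart x i)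
  outerDart-outer x∈ i = F.∼-trans x∈ (toℕ i , refl)

  inner-or-outer-vertex : ∀ x → innerVertex x ⊎ ∃[ i ] outerDart r i V.∼ x
  inner-or-outer-vertex x with Fin.any? (λ y → (x V.∼? y) ×-dec onOuter? y)
  ... | yes (y , x∼y , y∈) with i , rᵢ≡y ← outerDart-index F.∼-refl y∈ =
    inj₂ (i , subst (V._∼ x) (sym rᵢ≡y) (V.∼-sym x∼y))
  ... | no ∄ = inj₁ λ k o → ∄ (iter σ k x , (k , refl) , o)

  OuterVerticesDistinct : Set
  OuterVerticesDistinct = ∀ {x y} → onOuter x → onOuter y → x V.∼ y → x ≡ y

  outer-vertices-distinct-or-shared : OuterVerticesDistinct ⊎ ∃₂ λ i j → i ≢ j × outerDart r i V.∼ outerDart r j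
  outer-vertices-distinct-or-shared
    with Fin.any? (λ i → Fin.any? λ j → ¬? (i Fin.≟ j) ×-dec (outerDart r i V.∼? outerDart r j))
  ... | yes (i , j , shared) = inj₂ (i , j , shared)
  ... | no ∄ = inj₁ distinct
    where
    distinct : OuterVerticesDistinct
    distinct x∈ y∈ x∼y
      with i , refl ← outerDart-index F.∼-refl x∈ | j , refl ← outerDart-index F.∼-refl y∈
      with i Fin.≟ j
    ... | yes refl = refl
    ... | no  i≢j  = ⊥-elim (∄ (i , j , i≢j , x∼y))

module Irreducibility {n : ℕ} (G : PlaneMap n) (irr : Irreducible G) where
  open PlaneMapProperties G

  reach-closed : (P : Fin n → Set) → (∀ {x} → P x → P (α x)) → (∀ {x} → P x → P (σ x)) →
                 ∀ {x y} → P x → P y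
  reach-closed P α-closed σ-closed {x} {y} = along (connected x y)
    where
    along : ∀ {x y} → Reach α σ x y → P x → P y
    along here        Px = Px
    along (viaα path) Px = along path (α-closed Px)
    along (viaσ path) Px = along path (σ-closed Px)

  cornerOf-φ : ∀ {x y} → iter φ 3 x ≡ x → cornerOf x y → cornerOf (φ x) y
  cornerOf-φ φ³x≡x (inj₁ x∼y)        = inj₂ (inj₂ (subst (V._∼ _) (sym φ³x≡x) x∼y))
  cornerOf-φ φ³x≡x (inj₂ (inj₁ φx∼y)) = inj₁ φx∼y
  cornerOf-φ φ³x≡x (inj₂ (inj₂ φ²x∼y)) = inj₂ (inj₁ φ²x∼y)

  module OuterVertex (distinct : OuterVerticesDistinct) {ρ} (ρ∈ : onOuter ρ) where
    ρ₁ ρ₂ ρ₃ : Fin n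
    ρ₁ = φ ρ
    ρ₂ = φ ρ₁
    ρ₃ = φ ρ₂

    apart : ∀ {i j} → i ≢ j → ¬ outerDart ρ i V.∼ outerDart ρ j
    apart {i} {j} i≢j ρᵢ∼ρⱼ =
      i≢j (outerDart-injective ρ∈ (distinct (outerDart-outer ρ∈ i) (outerDart-outer ρ∈ j) ρᵢ∼ρⱼ))

    -- If the vertex of ρ has only its two outer edges, the inner face of α ρ has corners ρ, ρ₁, ρ₃, so
    -- ρ₁ρ₂ρ₃ is a triangle.  Irreducibility makes it facial; with one orientation its face would be the
    -- outer face, with the other (ReversedFace) the map is just the 4-cycle with the chord ρ₁ρ₃,
    -- which has no inner vertex.
    module DegreeTwo (σρ≡αρ₃ : σ ρ ≡ α ρ₃) where
      A w : Fin n
      A = α ρ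
      w = σ ρ₃

      A∉ : ¬ onOuter A
      A∉ A∈ = apart {0F} {2F} (λ ()) (1 , cong σ (α-swap A≡ρ₁))
        where
        A≡ρ₁ : A ≡ ρ₁
        A≡ρ₁ = distinct A∈ (outerDart-outer ρ∈ 1F) (1 , refl)

      φw : φ w ≡ A
      φw = begin
        φ w               ≡⟨ cong (φ ∘ σ) (α-invol ρ₃) ⟨
        φ (φ (α ρ₃))      ≡⟨ cong (φ ∘ φ) φA≡αρ₃ ⟨
        φ (φ (φ A))       ≡⟨ proj₁ (innerTri A A∉) ⟩
        A                 ∎
        where
        open ≡-Reasoning
        φA≡αρ₃ : φ A ≡ α ρ₃
        φA≡αρ₃ = trans (cong σ (α-invol ρ)) σρ≡αρ₃

      αw∼ρ₁ : α w V.∼ ρ₁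
      αw∼ρ₁ = 2 , cong σ φw

      separating : triangle ρ₁ ρ₂ ρ₃
      separating = (ρ₁ , V.∼-refl , (1 , refl)) , (ρ₂ , V.∼-refl , (1 , refl)) , (w , (1 , refl) , αw∼ρ₁)
                 , apart {1F} {2F} (λ ()) , apart {2F} {3F} (λ ()) , apart {3F} {1F} (λ ())

      module ReversedFace {y} (φ³y≡y : iter φ 3 y ≡ y)
                          (y∼ρ₁ : y V.∼ ρ₁) (φy∼ρ₃ : φ y V.∼ ρ₃) (φ²y∼ρ₂ : φ (φ y) V.∼ ρ₂) where
        y≡αw : y ≡ α w
        y≡αw = noMultiple y (α w) (V.∼-trans y∼ρ₁ (V.∼-sym αw∼ρ₁))
                 (subst (V._∼_ (α y)) (sym (α-invol w)) (V.∼-trans (1 , refl) (V.∼-trans φy∼ρ₃ (1 , refl))))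

        φy≡αρ₂ : φ y ≡ α ρ₂
        φy≡αρ₂ = noMultiple (φ y) (α ρ₂) (V.∼-trans φy∼ρ₃ (V.∼-sym (1 , refl)))
                   (subst (V._∼_ (α (φ y))) (sym (α-invol ρ₂)) (V.∼-trans (1 , refl) φ²y∼ρ₂))

        φ²y≡αρ₁ : φ (φ y) ≡ α ρ₁
        φ²y≡αρ₁ = noMultiple (φ (φ y)) (α ρ₁) (V.∼-trans φ²y∼ρ₂ (V.∼-sym (1 , refl)))
                    (subst (V._∼_ (α (φ (φ y)))) (sym (α-invol ρ₁)) (V.∼-trans (1 , φ³y≡y) y∼ρ₁))

        σρ₁ : σ ρ₁ ≡ α w
        σρ₁ = trans (cong σ (sym (α-invol ρ₁))) (trans (cong φ (sym φ²y≡αρ₁)) (trans φ³y≡y y≡αw))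

        σρ₂ : σ ρ₂ ≡ α ρ₁
        σρ₂ = trans (cong σ (sym (α-invol ρ₂))) (trans (cong φ (sym φy≡αρ₂)) φ²y≡αρ₁)

        σw : σ w ≡ α ρ₂
        σw = trans (cong σ (sym (α-invol w))) (trans (cong φ (sym y≡αw)) φy≡αρ₂)

        K : Fin 10 → Fin n
        K 0F = ρ
        K 1F = ρ₁
        K 2F = ρ₂
        K 3F = ρ₃
        K 4F = α ρ
        K 5F = α ρ₁
        K 6F = α ρ₂
        K 7F = α ρ₃
        K 8F = w
        K 9F = α w

        InK : Fin n → Set
        InK x = ∃[ k ] K k ≡ x

        σ-closed : ∀ k → InK (σ (K k))
        σ-closed 0F = 7F , sym σρ≡αρ₃
        σ-closed 1F = 9F , sym σρ₁
        σ-closed 2F = 5F , sym σρ₂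
        σ-closed 3F = 8F , refl
        σ-closed 4F = 1F , refl
        σ-closed 5F = 2F , refl
        σ-closed 6F = 3F , refl
        σ-closed 7F = 0F , sym (outer-period ρ∈)
        σ-closed 8F = 6F , sym σw
        σ-closed 9F = 4F , sym φw

        α-closed : ∀ k → InK (α (K k))
        α-closed 0F = 4F , refl
        α-closed 1F = 5F , refl
        α-closed 2F = 6F , refl
        α-closed 3F = 7F , refl
        α-closed 4F = 0F , sym (α-invol ρ)
        α-closed 5F = 1F , sym (α-invol ρ₁)
        α-closed 6F = 2F , sym (α-invol ρ₂)
        α-closed 7F = 3F , sym (α-invol ρ₃)
        α-closed 8F = 9F , refl
        α-closed 9F = 8F , sym (α-invol w)

        at-outer-vertex : ∀ k → ∃[ j ] onOuter (iter σ j (K k))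
        at-outer-vertex 0F = 0 , outerDart-outer ρ∈ 0F
        at-outer-vertex 1F = 0 , outerDart-outer ρ∈ 1F
        at-outer-vertex 2F = 0 , outerDart-outer ρ∈ 2F
        at-outer-vertex 3F = 0 , outerDart-outer ρ∈ 3F
        at-outer-vertex 4F = 1 , outerDart-outer ρ∈ 1F
        at-outer-vertex 5F = 1 , outerDart-outer ρ∈ 2F
        at-outer-vertex 6F = 1 , outerDart-outer ρ∈ 3F
        at-outer-vertex 7F = 1 , subst onOuter (sym (outer-period ρ∈)) ρ∈
        at-outer-vertex 8F = 2 , subst onOuter (sym (cong σ σw)) (outerDart-outer ρ∈ 3F)
        at-outer-vertex 9F = 2 , subst onOuter (sym (cong σ φw)) (outerDart-outer ρ∈ 1F)

        no-inner-vertex : ⊥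
        no-inner-vertex with z , z-inner ← proj₂ irr
          with k , Kk≡z ← reach-closed InK (λ { (k , refl) → α-closed k }) (λ { (k , refl) → σ-closed k })
                                        {y = z} (0F , refl)
          with j , outer ← at-outer-vertex k = z-inner j (subst (λ v → onOuter (iter σ j v)) Kk≡z outer)

      corners-excluded : ∀ {y} → iter φ 3 y ≡ y → y V.∼ ρ₁ → cornerOf y ρ₂ → cornerOf y ρ₃ → ⊥
      corners-excluded _ y∼ρ₁ (inj₁ y∼ρ₂) _ = apart {1F} {2F} (λ ()) (V.∼-trans (V.∼-sym y∼ρ₁) y∼ρ₂)
      corners-excluded _ y∼ρ₁ _ (inj₁ y∼ρ₃) = apart {1F} {3F} (λ ()) (V.∼-trans (V.∼-sym y∼ρ₁) y∼ρ₃)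
      corners-excluded _ _ (inj₂ (inj₁ φy∼ρ₂)) (inj₂ (inj₁ φy∼ρ₃)) =
        apart {2F} {3F} (λ ()) (V.∼-trans (V.∼-sym φy∼ρ₂) φy∼ρ₃)
      corners-excluded _ _ (inj₂ (inj₂ φ²y∼ρ₂)) (inj₂ (inj₂ φ²y∼ρ₃)) =
        apart {2F} {3F} (λ ()) (V.∼-trans (V.∼-sym φ²y∼ρ₂) φ²y∼ρ₃)
      corners-excluded {y} φ³y≡y y∼ρ₁ (inj₂ (inj₁ φy∼ρ₂)) (inj₂ (inj₂ _)) =
        outer-NoPeriodBelow-4 (outerDart-outer ρ∈ 1F) 3 (s≤s z≤n) ≤-refl (subst (λ v → iter φ 3 v ≡ v) y≡ρ₁ φ³y≡y)
        where
        y≡ρ₁ : y ≡ ρ₁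
        y≡ρ₁ = noMultiple y ρ₁ y∼ρ₁ (V.∼-trans (1 , refl) (V.∼-trans φy∼ρ₂ (V.∼-sym (1 , refl))))
      corners-excluded φ³y≡y y∼ρ₁ (inj₂ (inj₂ φ²y∼ρ₂)) (inj₂ (inj₁ φy∼ρ₃)) =
        ReversedFace.no-inner-vertex φ³y≡y y∼ρ₁ φy∼ρ₃ φ²y∼ρ₂

      facial-excluded : facial ρ₁ ρ₂ ρ₃ → ⊥
      facial-excluded (y , φ³y≡y , inj₁ y∼ρ₁ , c₂ , c₃) = corners-excluded φ³y≡y y∼ρ₁ c₂ c₃
      facial-excluded (y , φ³y≡y , inj₂ (inj₁ φy∼ρ₁) , c₂ , c₃) =
        corners-excluded (cong φ φ³y≡y) φy∼ρ₁ (cornerOf-φ φ³y≡y c₂) (cornerOf-φ φ³y≡y c₃)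
      facial-excluded (y , φ³y≡y , inj₂ (inj₂ φ²y∼ρ₁) , c₂ , c₃) =
        corners-excluded (cong (φ ∘ φ) φ³y≡y) φ²y∼ρ₁
          (cornerOf-φ φ⁴y≡φy (cornerOf-φ φ³y≡y c₂)) (cornerOf-φ φ⁴y≡φy (cornerOf-φ φ³y≡y c₃))
        where
        φ⁴y≡φy : iter φ 3 (φ y) ≡ φ y
        φ⁴y≡φy = cong φ φ³y≡y

      impossible : ⊥
      impossible = facial-excluded (proj₁ irr ρ₁ ρ₂ ρ₃ separating)

    σρ-inner : ¬ onOuter (σ ρ)
    σρ-inner σρ∈ = apart {3F} {1F} (λ ()) (1 , cong σ (α-swap αρ₃≡ρ))
      where
      αρ₃≡ρ : α ρ₃ ≡ ρ
      αρ₃≡ρ = V.f-injective (trans (outer-period ρ∈) (sym (distinct σρ∈ ρ∈ (V.∼-sym (1 , refl)))))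

    degree-two : onOuter (α (σ ρ)) → σ ρ ≡ α ρ₃
    degree-two ασρ∈ = trans (sym (α-invol (σ ρ))) (cong α (F.f-injective (trans φy≡ρ (sym (outer-period ρ∈)))))
      where
      φy≡ρ : φ (α (σ ρ)) ≡ ρ
      φy≡ρ = distinct (onOuter-φ ασρ∈) ρ∈ (V.∼-sym (2 , sym (cong σ (α-invol (σ ρ)))))

    inner-edge-at : ∃[ e ] ρ V.∼ e × innerEdge e
    inner-edge-at with onOuter? (σ ρ) | onOuter? (α (σ ρ))
    ... | yes σρ∈ | _        = ⊥-elim (σρ-inner σρ∈)
    ... | no σρ∉  | no ασρ∉  = σ ρ , (1 , refl) , Data.Sum.[ σρ∉ , ασρ∉ ]
    ... | no _    | yes ασρ∈ = ⊥-elim (DegreeTwo.impossible (degree-two ασρ∈))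

module Colouring {n : ℕ} (G : PlaneMap n) (col : Fin n → Bool) (tc : TransversalColouring G col) where
  open PlaneMapProperties G
  open TransversalColouring tc

  bichromatic : Fin n → ℕ
  bichromatic x = 𝟙 (col x xor col (σ x))

  numBichromatic : ℕ
  numBichromatic = sum bichromatic

  faceChange faceChanges : Fin n → ℕ
  faceChange x  = 𝟙 (col x xor col (φ x))
  faceChanges x = faceChange x + faceChange (φ x) + faceChange (φ (φ x))

  numBichromatic-faces : numBichromatic ≡ sum faceChange
  numBichromatic-faces = begin
    sum bichromatic       ≡⟨ sum-∘-inverse α α α-invol α-invol bichromatic ⟨
    sum (bichromatic ∘ α) ≡⟨ sum-cong-≗ (λ x → cong (λ c → 𝟙 (c xor col (φ x))) (edgeColour x)) ⟩
    sum faceChange        ∎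
    where open ≡-Reasoning

  outer-faceChange : ∀ {x} → onOuter x → faceChange x ≡ 0
  outer-faceChange {x} x∈ rewrite outerBlue x (inj₁ x∈) | outerBlue (φ x) (inj₁ (onOuter-φ x∈)) = refl

  outer-faceChanges : ∀ {x} → onOuter x → faceChanges x ≡ 0
  outer-faceChanges x∈ = cong₂ _+_ (cong₂ _+_ (outer-faceChange x∈) (outer-faceChange (onOuter-φ x∈)))
                                    (outer-faceChange (onOuter-φ (onOuter-φ x∈)))

  inner-faceChanges : ∀ {x} → ¬ onOuter x → faceChanges x ≤ 2
  inner-faceChanges {x} x∉ = subst (λ y → faceChange x + faceChange (φ x) + 𝟙 (col (φ (φ x)) xor col y) ≤ 2)
                                   (sym (proj₁ (innerTri x x∉))) (xor-cycle-≤-2 (col x) (col (φ x)) (col (φ (φ x))))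

  faceChanges-≤ : ∀ x → faceChanges x ≤ 2 * inner x
  faceChanges-≤ x with onOuter? x
  ... | yes x∈ = subst (_≤ 2 * inner x) (sym (outer-faceChanges x∈)) z≤n
  ... | no  x∉ = subst (faceChanges x ≤_) (cong (2 *_) (sym (inner-1 x∉))) (inner-faceChanges x∉)

  module MonochromaticFace {x} (x∉ : ¬ onOuter x) (mono : col x ≡ col (φ x) × col (φ x) ≡ col (φ (φ x))) where

    face-colour : ∀ j → col (iter φ j x) ≡ col x
    face-colour j with i , i<3 , φⁱx≡φʲx ← F.∼-within-period (proj₁ (innerTri x x∉)) (j , refl) =
      trans (cong col (sym φⁱx≡φʲx)) (corner-colour i i<3)
      where
      corner-colour : ∀ i → i < 3 → col (iter φ i x) ≡ col x
      corner-colour 0 _ = refl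
      corner-colour 1 _ = sym (proj₁ mono)
      corner-colour 2 _ = sym (trans (proj₁ mono) (proj₂ mono))
      corner-colour (suc (suc (suc _))) (s≤s (s≤s (s≤s ())))

    no-faceChanges : ∀ j → faceChanges (iter φ j x) ≡ 0
    no-faceChanges j = cong₂ _+_ (cong₂ _+_ (no-change j) (no-change (suc j))) (no-change (suc (suc j)))
      where
      no-change : ∀ j → faceChange (iter φ j x) ≡ 0
      no-change j rewrite face-colour j | face-colour (suc j) | xor-same (col x) = refl

    angles-≤ : 3 * numBichromatic + 6 ≤ 2 * numInner
    angles-≤ = begin
      3 * numBichromatic + 6         ≡⟨ cong (λ s → 3 * s + 6) numBichromatic-faces ⟩
      3 * sum faceChange + 6         ≡⟨ cong (_+ 6) (3*sum≡sum-rotations φ φ⁻¹ φ∘φ⁻¹ φ⁻¹∘φ faceChange) ⟩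
      sum faceChanges + 6            ≤⟨ sum-slack {c = 2} faceChanges-≤ (F.iterates-Unique (inner-NoPeriodBelow-3 x∉))
                                                  (applyUpTo⁺₂ _ 3 slack) ⟩
      sum (λ y → 2 * inner y)        ≡⟨ *-distribˡ-sum 2 inner ⟨
      2 * numInner                   ∎
      where
      open ≤-Reasoning
      slack : ∀ j → 2 + faceChanges (iter φ j x) ≤ 2 * inner (iter φ j x)
      slack j rewrite no-faceChanges j | inner-1 (¬onOuter-iter x∉ j) = ≤-refl

  bichromatic-≢ : ∀ {x} → col x ≢ col (σ x) → 1 ≤ bichromatic x
  bichromatic-≢ {x} ne with col x | col (σ x)
  ... | true  | true  = ⊥-elim (ne refl)
  ... | true  | false = ≤-refl
  ... | false | true  = ≤-refl
  ... | false | false = ⊥-elim (ne refl)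

  colour-change-at-vertex : ∀ {x y z} → y V.∼ x → y V.∼ z → col y ≢ col z →
                            ∃[ u ] u V.∼ x × col u ≡ col y × 1 ≤ bichromatic u
  colour-change-at-vertex {x} {y} y∼x (k , σᵏy≡z) col-y≢z =
    at-change (change-point (λ j → col (iter σ j y)) {k = k} refl (trans (cong col σᵏy≡z) (¬-not (col-y≢z ∘ sym))))
    where
    at-change : ∃[ j ] col (iter σ j y) ≡ col y × col (iter σ (suc j) y) ≡ not (col y) →
                ∃[ u ] u V.∼ x × col u ≡ col y × 1 ≤ bichromatic u
    at-change (j , cⱼ , cⱼ₊₁) =
      iter σ j y , V.∼-trans (V.∼-sym (j , refl)) y∼x , cⱼ , bichromatic-≢ λ eq → not-¬ cⱼ (trans eq cⱼ₊₁)

  two-colours : ∀ {x y z} → y V.∼ x → z V.∼ x → col y ≢ col z → 2 ≤ V.orbitMass bichromatic id x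
  two-colours {x} {y} {z} y∼x z∼x col-y≢z =
    count (colour-change-at-vertex y∼x (V.∼-trans y∼x (V.∼-sym z∼x)) col-y≢z)
          (colour-change-at-vertex z∼x (V.∼-trans z∼x (V.∼-sym y∼x)) (col-y≢z ∘ sym))
    where
    count : ∃[ u ] u V.∼ x × col u ≡ col y × 1 ≤ bichromatic u →
            ∃[ v ] v V.∼ x × col v ≡ col z × 1 ≤ bichromatic v → 2 ≤ V.orbitMass bichromatic id x
    count (u , u∼x , col-u , u-bi) (v , v∼x , col-v , v-bi) =
      V.orbitMass-≥ bichromatic id ((u≢v ∷ []) ∷ [] ∷ []) ((u∼x , u-bi) ∷ (v∼x , v-bi) ∷ [])
      where
      u≢v : u ≢ v
      u≢v u≡v = col-y≢z (trans (sym col-u) (trans (cong col u≡v) col-v))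

  colour-change : ∀ {d₀ A B C c} → A < B → B < C →
                  (∀ j → A ≤ j → j < B → col (iter σ j d₀) ≡ c) →
                  (∀ j → B ≤ j → j < C → col (iter σ j d₀) ≡ not c) → 1 ≤ bichromatic (iter σ (B ∸ 1) d₀)
  colour-change {B = suc b} A<B B<C before after =
    bichromatic-≢ λ eq → not-¬ (before b (s≤s⁻¹ A<B) ≤-refl) (trans eq (after (suc b) ≤-refl B<C))

  colour-next-turn : ∀ {d₀ L P c} → iter σ L d₀ ≡ d₀ → (∀ j → j < P → col (iter σ j d₀) ≡ c) →
                     ∀ j → L ≤ j → j < L + P → col (iter σ j d₀) ≡ c
  colour-next-turn {d₀} {L} {P} {c} σᴸd₀≡d₀ first-turn j L≤j j<L+P = begin
    col (iter σ j d₀)                  ≡⟨ cong (λ m → col (iter σ m d₀)) (m∸n+n≡m L≤j) ⟨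
    col (iter σ (j ∸ L + L) d₀)        ≡⟨ cong col (V.iter-+ (j ∸ L) L d₀) ⟩
    col (iter σ (j ∸ L) (iter σ L d₀)) ≡⟨ cong (col ∘ iter σ (j ∸ L)) σᴸd₀≡d₀ ⟩
    col (iter σ (j ∸ L) d₀)
      ≡⟨ first-turn (j ∸ L) (subst (j ∸ L <_) (m+n∸m≡n L P) (∸-monoˡ-< j<L+P L≤j)) ⟩
    c                                  ∎
    where open ≡-Reasoning

  inner-vertex-bichromatic : ∀ {x} → innerVertex x → 4 ≤ V.orbitMass bichromatic id x
  inner-vertex-bichromatic {x} x-inner
    with d₀ , x∼d₀ , p , q , s , t , 1≤p@(s≤s z≤n) , 1≤q , 1≤s , 1≤t , period , aperiodic
       , red₁ , blue₁ , red₂ , blue₂ ← C1 x x-inner =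
    -- matching 1 ≤ p makes p, and with it every boundary B below, a successor, so that B ∸ 1 computes
    V.orbitMass-≥ bichromatic id
      (V.iterates-Unique-at aperiodic (Linked⇒AllPairs <-trans (b₁<b₂ ∷ b₂<b₃ ∷ b₃<b₄ ∷ [-]))
                                      (b₁<L ∷ b₂<L ∷ b₃<L ∷ b₄<L ∷ []))
      ( (on-vertex b₁ , colour-change {A = 0} 1≤p B₁<B₂ (λ j _ → red₁ j) blue₁)
      ∷ (on-vertex b₂ , colour-change B₁<B₂ B₂<B₃ blue₁ red₂)
      ∷ (on-vertex b₃ , colour-change B₂<B₃ B₃<L red₂ blue₂)
      ∷ (on-vertex b₄ , colour-change B₃<L (m<m+n L 1≤p) blue₂ (colour-next-turn period red₁)) ∷ [])
    where
    L b₁ b₂ b₃ b₄ : ℕ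
    L  = p + q + s + t
    b₁ = p ∸ 1
    b₂ = p + q ∸ 1
    b₃ = p + q + s ∸ 1
    b₄ = L ∸ 1

    B₁<B₂ : p < p + q
    B₁<B₂ = m<m+n p 1≤q
    B₂<B₃ : p + q < p + q + s
    B₂<B₃ = m<m+n (p + q) 1≤s
    B₃<L : p + q + s < L
    B₃<L = m<m+n (p + q + s) 1≤t

    b₁<b₂ : b₁ < b₂
    b₁<b₂ = s<s⁻¹ B₁<B₂
    b₂<b₃ : b₂ < b₃
    b₂<b₃ = s<s⁻¹ B₂<B₃
    b₃<b₄ : b₃ < b₄
    b₃<b₄ = s<s⁻¹ B₃<L
    b₄<L : b₄ < L
    b₄<L = ≤-refl
    b₃<L : b₃ < L
    b₃<L = <-trans b₃<b₄ b₄<L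
    b₂<L : b₂ < L
    b₂<L = <-trans b₂<b₃ b₃<L
    b₁<L : b₁ < L
    b₁<L = <-trans b₁<b₂ b₂<L

    on-vertex : ∀ j → iter σ j d₀ V.∼ x
    on-vertex j = V.∼-trans (V.∼-sym (j , refl)) (V.∼-sym x∼d₀)

module VertexCount {n : ℕ} (G : PlaneMap n) (irr : Irreducible G) (col : Fin n → Bool) (tc : TransversalColouring G col) where
  open PlaneMapProperties G
  open Irreducibility G irr
  open Colouring G col tc
  open TransversalColouring tc

  vertices-≤-by : (w : Fin 4 → ℕ) →
                  (∀ k {x} → outerDart r k V.∼ x → 4 ≤ V.orbitMass bichromatic id x + V.orbitMass w (outerDart r) x) →
                  4 * numOrbits σ ≤ numBichromatic + sum w
  vertices-≤-by w outer-heavy = V.orbits-≤ bichromatic w (outerDart r) heavy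
    where
    heavy : ∀ x → 4 ≤ V.orbitMass bichromatic id x + V.orbitMass w (outerDart r) x
    heavy x with inner-or-outer-vertex x
    ... | inj₁ x-inner     = ≤-trans (inner-vertex-bichromatic x-inner) (m≤m+n _ _)
    ... | inj₂ (k , rₖ∼x) = outer-heavy k rₖ∼x

  allBut : Fin 4 → Fin 4 → ℕ
  allBut j k = if does (k Fin.≟ j) then 0 else 4

  sum-allBut : ∀ j → sum (allBut j) ≡ 12
  sum-allBut 0F = refl
  sum-allBut 1F = refl
  sum-allBut 2F = refl
  sum-allBut 3F = refl

  -- With at most three outer vertices, weight 4 at all outer corners but one suffices.
  shared-vertex-≤ : ∀ {i j} → i ≢ j → outerDart r i V.∼ outerDart r j → 4 * numOrbits σ ≤ numBichromatic + 12
  shared-vertex-≤ {i} {j} i≢j rᵢ∼rⱼ =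
    subst (λ m → 4 * numOrbits σ ≤ numBichromatic + m) (sum-allBut j) (vertices-≤-by (allBut j) heavy)
    where
    four : ∀ {k} → k ≢ j → allBut j k ≡ 4
    four {k} k≢j rewrite dec-false (k Fin.≟ j) k≢j = refl
    heavy-at : ∀ {k x} → k ≢ j → outerDart r k V.∼ x →
               4 ≤ V.orbitMass bichromatic id x + V.orbitMass (allBut j) (outerDart r) x
    heavy-at {k} {x} k≢j rₖ∼x =
      ≤-trans (subst (_≤ _) (four k≢j) (V.orbitMass-≥-point (allBut j) (outerDart r) {x} {k} rₖ∼x))
              (m≤n+m _ (V.orbitMass bichromatic id x))
    heavy : ∀ k {x} → outerDart r k V.∼ x →
            4 ≤ V.orbitMass bichromatic id x + V.orbitMass (allBut j) (outerDart r) x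
    heavy k rₖ∼x with k Fin.≟ j
    ... | yes refl = heavy-at i≢j (V.∼-trans rᵢ∼rⱼ rₖ∼x)
    ... | no  k≢j  = heavy-at k≢j rₖ∼x

  innerColour : Bool → Fin 4 → Bool
  innerColour c 0F = c
  innerColour c 1F = not c
  innerColour c 2F = c
  innerColour c 3F = not c

  innerColour-correct : ∀ k {e} → innerEdge e → outerDart r k V.∼ e → col e ≡ innerColour (proj₁ C2) k
  innerColour-correct 0F e-inner rₖ∼e = proj₁ (proj₂ C2) _ e-inner (inj₁ rₖ∼e)
  innerColour-correct 1F e-inner rₖ∼e = proj₂ (proj₂ C2) _ e-inner (inj₁ rₖ∼e)
  innerColour-correct 2F e-inner rₖ∼e = proj₁ (proj₂ C2) _ e-inner (inj₂ rₖ∼e)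
  innerColour-correct 3F e-inner rₖ∼e = proj₂ (proj₂ C2) _ e-inner (inj₂ rₖ∼e)

  colourWeight : Bool → ℕ
  colourWeight b = if b then 2 else 4

  sum-colourWeight : ∀ c → sum (colourWeight ∘ innerColour c) ≡ 12
  sum-colourWeight true  = refl
  sum-colourWeight false = refl

  -- The two outer vertices whose inner edges are red need weight 2 only: their blue outer edges
  -- already give them two bichromatic angles.
  distinct-vertices-≤ : OuterVerticesDistinct → 4 * numOrbits σ ≤ numBichromatic + 12
  distinct-vertices-≤ distinct =
    subst (λ m → 4 * numOrbits σ ≤ numBichromatic + m) (sum-colourWeight c) (vertices-≤-by w heavy)
    where
    c : Bool
    c = proj₁ C2
    w : Fin 4 → ℕ
    w = colourWeight ∘ innerColour c
    heavy : ∀ k {x} → outerDart r k V.∼ x → 4 ≤ V.orbitMass bichromatic id x + V.orbitMass w (outerDart r) x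
    heavy k {x} rₖ∼x with innerColour c k in red-inside | V.orbitMass-≥-point w (outerDart r) {x} {k} rₖ∼x
    ... | false | 4≤mass = ≤-trans 4≤mass (m≤n+m _ (V.orbitMass bichromatic id x))
    ... | true  | 2≤mass with e , rₖ∼e , e-inner ← OuterVertex.inner-edge-at distinct (outerDart-outer F.∼-refl k) =
      +-mono-≤ (two-colours rₖ∼x (V.∼-trans (V.∼-sym rₖ∼e) rₖ∼x) blue≢red) 2≤mass
      where
      rₖ-blue : col (outerDart r k) ≡ blue
      rₖ-blue = outerBlue (outerDart r k) (inj₁ (outerDart-outer F.∼-refl k))
      e-red : col e ≡ red
      e-red = trans (innerColour-correct k e-inner rₖ∼e) red-inside
      blue≢red : col (outerDart r k) ≢ col e
      blue≢red eq with () ← trans (sym rₖ-blue) (trans eq e-red)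

  vertices-≤ : 4 * numOrbits σ ≤ numBichromatic + 12
  vertices-≤ with outer-vertices-distinct-or-shared
  ... | inj₁ distinct              = distinct-vertices-≤ distinct
  ... | inj₂ (i , j , i≢j , rᵢ∼rⱼ) = shared-vertex-≤ i≢j rᵢ∼rⱼ

euler-contradiction : ∀ {V F S I n} → 2 * V + 2 * F ≡ n + 4 → 3 * F ≤ I + 3 → 3 * S + 6 ≤ 2 * I → 4 * V ≤ S + 12 →
                      I + 4 ≤ n → ⊥
euler-contradiction {V} {F} {S} {I} {n} euler faces angles vertices darts = <-irrefl refl (begin-strict
  6 * (n + 4)                ≡⟨ cong (6 *_) euler ⟨
  6 * (2 * V + 2 * F)        ≡⟨ regroup₁ V F ⟩
  3 * (4 * V) + 4 * (3 * F)  ≤⟨ +-mono-≤ (*-monoʳ-≤ 3 vertices) (*-monoʳ-≤ 4 faces) ⟩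
  3 * (S + 12) + 4 * (I + 3) ≡⟨ regroup₂ S I ⟩
  (3 * S + 6) + 4 * I + 42   ≤⟨ +-monoˡ-≤ 42 (+-monoˡ-≤ (4 * I) angles) ⟩
  2 * I + 4 * I + 42         ≡⟨ regroup₃ I ⟩
  6 * (I + 4) + 18           ≤⟨ +-monoˡ-≤ 18 (*-monoʳ-≤ 6 darts) ⟩
  6 * n + 18                 <⟨ +-monoʳ-< (6 * n) (m<m+n 18 {6} (s≤s z≤n)) ⟩
  6 * n + 24                 ≡⟨ regroup₄ n ⟩
  6 * (n + 4)                ∎)
  where
  open ≤-Reasoning
  regroup₁ : ∀ V F → 6 * (2 * V + 2 * F) ≡ 3 * (4 * V) + 4 * (3 * F)
  regroup₁ = solve-∀
  regroup₂ : ∀ S I → 3 * (S + 12) + 4 * (I + 3) ≡ (3 * S + 6) + 4 * I + 42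
  regroup₂ = solve-∀
  regroup₃ : ∀ I → 2 * I + 4 * I + 42 ≡ 6 * (I + 4) + 18
  regroup₃ = solve-∀
  regroup₄ : ∀ n → 6 * n + 24 ≡ 6 * (n + 4)
  regroup₄ = solve-∀

lemma5 : ∀ {n} (T : PlaneMap n) → Irreducible T → (col : Fin n → Bool) → TransversalColouring T col →
    ∀ d → ¬ PlaneMap.onOuter T d →
      ¬ (col d ≡ col (PlaneMap.φ T d) × col (PlaneMap.φ T d) ≡ col (PlaneMap.φ T (PlaneMap.φ T d)))
lemma5 T irr col tc d d∉ mono =
  euler-contradiction {numOrbits σ} {numOrbits φ} euler faces-≤ angles-≤ vertices-≤ numInner+4≤n
  where
  open PlaneMapProperties T
  open Colouring T col tc
  open MonochromaticFace d∉ mono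
  open VertexCount T irr col tc
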